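{- For \textsf{MAXCONNECTIVITY} on a path, the power of preemption is unbounded: there exists an instance on a path for which every non-preemptive schedule has total connectivity time $0$, while some preemptive schedule has positive total connectivity time.
   Context: An instance consists of a graph $G=(V,E)$ which is a path from $s^+$ to $s^-$, and, for every edge $e$, a maintenance job with processing time $p_e\in\mathbb{Z}_{\ge0}$, release date $r_e$ and deadline $d_e$ (nonnegative integers). A schedule assigns to each edge $e$ a finite set of disjoint intervals within $[r_e,d_e]$ of total length $p_e$ (preemptive, arbitrary real preemption) or a single such interval (non-preemptive); edge $e$ is unavailable during these intervals; arbitrarily many edges may be maintained simultaneously. Time horizon $T=\max_e d_e$. The network is connected at time $t$ if no edge of the path is maintained at $t$. \textsf{MAXCONNECTIVITY} maximizes the measure of connected times in $[0,T]$. The power of preemption is the maximum ratio of the optimal preemptive value to the optimal non-preemptive value.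
   Formalization: Times are rational: the non-preemptive schedules range only over rational start times rather than real ones, and the interval endpoints of the preemptive schedule are taken in ℚ. -}

module Defs where

open import Data.Nat using (ℕ)
open import Data.Integer using (+_)
open import Data.Rational using (ℚ; _+_; _-_; _*_; _/_; _≤_; _<_; ½; 0ℚ)
open import Data.Rational.Properties using (_≤?_; ≤-decTotalOrder)
open import Data.Fin using (Fin)
open import Data.List using (List; []; _∷_; map; concatMap; foldr; [_])
open import Data.Bool.ListAction using (any; all)
open import Data.List.Sort ≤-decTotalOrder using (sort)
open import Data.List.Relation.Unary.All using (All)
open import Data.List.Relation.Unary.AllPairs using (AllPairs)
open import Data.Product using (_×_; _,_; proj₁; proj₂)
open import Data.Sum using (_⊎_)
open import Data.Bool using (Bool; true; false; not; _∧_; if_then_else_)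
open import Relation.Nullary using (does)
open import Relation.Binary.PropositionalEquality using (_≡_)

ℕ→ℚ : ℕ → ℚ
ℕ→ℚ n = + n / 1

-- A maintenance job: processing time p, release date r, deadline d.
record Job : Set where
  constructor job
  field
    p r d : ℕ
open Job public

-- An instance on a path with m edges (edges indexed by Fin m, in path order).
record Instance : Set where
  constructor inst
  field
    m    : ℕ
    jobs : Fin m → Job
open Instance public

allEdges : (m : ℕ) → List (Fin m)
allEdges m = Data.List.allFin m
  where import Data.List

horizon : Instance → ℕ
horizon I = foldr Data.Nat._⊔_ 0 (map (λ e → d (jobs I e)) (allEdges (m I)))
  where import Data.Nat

Interval : Set
Interval = ℚ × ℚ

len : Interval → ℚ
len (a , b) = b - a

Disjoint : Interval → Interval → Set
Disjoint (a , b) (a' , b') = (b < a') ⊎ (b' < a)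

Schedule : Instance → Set
Schedule I = Fin (m I) → List Interval

ValidFor : Job → List Interval → Set
ValidFor j is =
  All (λ { (a , b) → (ℕ→ℚ (r j) ≤ a) × (a ≤ b) × (b ≤ ℕ→ℚ (d j)) }) is
  × AllPairs Disjoint is
  × foldr (λ iv acc → len iv + acc) 0ℚ is ≡ ℕ→ℚ (p j)

PreemptiveSchedule : Instance → Set
PreemptiveSchedule I = Fin (m I) → List Interval

ValidPreemptive : (I : Instance) → PreemptiveSchedule I → Set
ValidPreemptive I σ = ∀ e → ValidFor (jobs I e) (σ e)

-- A non-preemptive schedule: one start time S_e per edge; edge e is
-- maintained during the single interval [S_e , S_e + p_e] ⊆ [r_e , d_e].
NonPreemptiveSchedule : Instance → Set
NonPreemptiveSchedule I = Fin (m I) → ℚ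

ValidNonPreemptive : (I : Instance) → NonPreemptiveSchedule I → Set
ValidNonPreemptive I S = ∀ e →
  (ℕ→ℚ (r (jobs I e)) ≤ S e) × (S e + ℕ→ℚ (p (jobs I e)) ≤ ℕ→ℚ (d (jobs I e)))

asSchedule : (I : Instance) → NonPreemptiveSchedule I → Schedule I
asSchedule I S e = [ (S e , S e + ℕ→ℚ (p (jobs I e))) ]

inIv : ℚ → Interval → Bool
inIv t (a , b) = does (a ≤? t) ∧ does (t ≤? b)

-- the network (a path) is connected at time t iff no edge is maintained at t
connectedAt : (I : Instance) → Schedule I → ℚ → Bool
connectedAt I σ t = all (λ e → not (any (inIv t) (σ e))) (allEdges (m I))

-- The maintained set is a
-- finite union of intervals, so its complement in [0,T] is measured exactly
-- by sorting all breakpoints (0, T, all interval endpoints, which lie in [0,T])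
-- and summing the lengths of the elementary segments whose midpoint is
-- a connected time (connectivity is constant on the interior of each segment).
breakpoints : (I : Instance) → Schedule I → List ℚ
breakpoints I σ =
  0ℚ ∷ ℕ→ℚ (horizon I) ∷
  concatMap (λ e → concatMap (λ { (a , b) → a ∷ b ∷ [] }) (σ e)) (allEdges (m I))

segSum : (ℚ → Bool) → List ℚ → ℚ
segSum c []             = 0ℚ
segSum c (x ∷ [])       = 0ℚ
segSum c (x ∷ y ∷ rest) =
  (if c ((x + y) * ½) then y - x else 0ℚ) + segSum c (y ∷ rest)

connectivity : (I : Instance) → Schedule I → ℚ
connectivity I σ = segSum (connectedAt I σ) (sort (breakpoints I σ))

{-# OPTIONS --safe #-}
-- Edges 1 and 3 are pinned to [0,1] and [2,3], and edge 2 needs two time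
-- units inside [0,3].  A single interval of length 2 in [0,3] always covers
-- [1,2], so every non-preemptive schedule cuts the path during all of [0,3];
-- splitting edge 2 into [0,1] and [2,3] leaves the path connected on (1,2).
module Submission where

open import Defs

open import Data.Nat as ℕ using (_⊔_)
import Data.Nat.Properties as ℕ
import Data.Nat.Coprimality as Coprime
open import Data.Integer as ℤ using (+_)
import Data.Integer.Properties as ℤ
open import Data.Rational using (ℚ; mkℚ; 0ℚ; _<_; _+_; _-_; _*_; _≤_; *≤*; ½; 1ℚ)
open import Data.Rational.Properties as ℚ using (_≤?_; _<?_; ≤-decTotalOrder; normalize-coprime)
open import Data.Fin using (zero; suc)
open import Data.List using ([]; _∷_; foldr)
open import Data.List.Membership.Propositional using (_∈_)
open import Data.List.Membership.Propositional.Properties using (∈-map⁺; ∈-allFin)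
open import Data.List.Relation.Unary.Any using (here; there)
open import Data.List.Relation.Unary.All using (All; []; _∷_)
open import Data.List.Relation.Unary.All.Properties as All using (tabulate⁺)
open import Data.List.Relation.Binary.Permutation.Propositional.Properties using (All-resp-↭)
open import Data.List.Relation.Unary.AllPairs using ([]; _∷_)
open import Data.List.Relation.Binary.Permutation.Propositional using (↭-sym; ↭-trans; ↭⇒↭ₛ)
open import Data.List.Relation.Binary.Pointwise using (Pointwise-≡⇒≡)
open import Data.List.Relation.Unary.Sorted.TotalOrder.Properties using (↗↭↗⇒≋)
import Data.List.Sort ≤-decTotalOrder as Sort
open import Data.List.Sort.InsertionSort ≤-decTotalOrder using (insertionSort)
open import Data.Bool using (Bool; true; false; not; _∧_; _∨_; if_then_else_)
open import Data.Bool.Properties using (∧-zeroʳ; ∨-zeroʳ)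
open import Data.Bool.ListAction using (any; all)
open import Data.Product using (Σ; _×_; ∃; _,_; proj₁; proj₂)
open import Data.Sum using (inj₁)
open import Relation.Nullary using (yes; no)
open import Relation.Nullary.Decidable using (True; toWitness; dec-true)
open import Relation.Binary.PropositionalEquality using (_≡_; refl; sym; trans; cong; cong₂; subst; subst₂; module ≡-Reasoning)
open import Relation.Binary.Bundles using (DecTotalOrder)

module InsertionSort = Sort.SortingAlgorithm insertionSort

-- `Sort.sort` is abstract and never reduces, so connectivity is evaluated through insertion sort.
sort≡insertionSort : ∀ xs → Sort.sort xs ≡ InsertionSort.sort xs
sort≡insertionSort xs = Pointwise-≡⇒≡ (↗↭↗⇒≋ totalOrder
  (Sort.sort-↗ xs) (InsertionSort.sort-↗ xs)
  (↭⇒↭ₛ (↭-trans (Sort.sort-↭ xs) (↭-sym (InsertionSort.sort-↭ xs)))))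
  where open DecTotalOrder ≤-decTotalOrder using (totalOrder)

any-true : ∀ {A : Set} {f : A → Bool} {x xs} → x ∈ xs → f x ≡ true → any f xs ≡ true
any-true (here refl) fx≡true rewrite fx≡true = refl
any-true {f = f} {xs = y ∷ _} (there x∈xs) fx≡true =
  trans (cong (f y ∨_) (any-true x∈xs fx≡true)) (∨-zeroʳ (f y))

all-false : ∀ {A : Set} {f : A → Bool} {x xs} → x ∈ xs → f x ≡ false → all f xs ≡ false
all-false (here refl) fx≡false rewrite fx≡false = refl
all-false {f = f} {xs = y ∷ _} (there x∈xs) fx≡false =
  trans (cong (f y ∧_) (all-false x∈xs fx≡false)) (∧-zeroʳ (f y))

≤-foldr-⊔ : ∀ {n ns} → n ∈ ns → n ℕ.≤ foldr _⊔_ 0 ns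
≤-foldr-⊔ {n} (here refl) = ℕ.m≤m⊔n n _
≤-foldr-⊔ {ns = m ∷ _} (there n∈ns) = ℕ.m≤n⇒m≤o⊔n m (≤-foldr-⊔ n∈ns)

deadline≤horizon : ∀ I e → d (jobs I e) ℕ.≤ horizon I
deadline≤horizon I e = ≤-foldr-⊔ (∈-map⁺ (λ e → d (jobs I e)) (∈-allFin e))

ℕ→ℚ≡mkℚ : ∀ n → ℕ→ℚ n ≡ mkℚ (+ n) 0 _
ℕ→ℚ≡mkℚ n = normalize-coprime (Coprime.sym (Coprime.1-coprimeTo n))

ℕ→ℚ-mono-≤ : ∀ {m n} → m ℕ.≤ n → ℕ→ℚ m ≤ ℕ→ℚ n
ℕ→ℚ-mono-≤ {m} {n} m≤n = subst₂ _≤_ (sym (ℕ→ℚ≡mkℚ m)) (sym (ℕ→ℚ≡mkℚ n))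
  (*≤* (subst₂ ℤ._≤_ (sym (ℤ.*-identityʳ (+ m))) (sym (ℤ.*-identityʳ (+ n))) (ℤ.+≤+ m≤n)))

ℕ→ℚ-nonNeg : ∀ n → 0ℚ ≤ ℕ→ℚ n
ℕ→ℚ-nonNeg n = ℕ→ℚ-mono-≤ (ℕ.z≤n {n})

p≤p+q : ∀ p {q} → 0ℚ ≤ q → p ≤ p + q
p≤p+q p 0≤q = subst (_≤ p + _) (ℚ.+-identityʳ p) (ℚ.+-monoʳ-≤ p 0≤q)

Between : ℚ → ℚ → ℚ → Set
Between a b t = a ≤ t × t ≤ b

[x+x]*½≡x : ∀ x → (x + x) * ½ ≡ x
[x+x]*½≡x x = begin
  (x + x) * ½    ≡⟨ ℚ.*-distribʳ-+ ½ x x ⟩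
  x * ½ + x * ½  ≡⟨ ℚ.*-distribˡ-+ x ½ ½ ⟨
  x * 1ℚ         ≡⟨ ℚ.*-identityʳ x ⟩
  x              ∎
  where open ≡-Reasoning

midpoint-between : ∀ {a b x y} → Between a b x → Between a b y → Between a b ((x + y) * ½)
midpoint-between {a} {b} (a≤x , x≤b) (a≤y , y≤b) =
  subst (_≤ _) ([x+x]*½≡x a) (ℚ.*-monoʳ-≤-nonNeg ½ (ℚ.+-mono-≤ a≤x a≤y)) ,
  subst (_ ≤_) ([x+x]*½≡x b) (ℚ.*-monoʳ-≤-nonNeg ½ (ℚ.+-mono-≤ x≤b y≤b))

inIv-between : ∀ {a b t} → Between a b t → inIv t (a , b) ≡ true
inIv-between {a} {b} {t} (a≤t , t≤b) rewrite dec-true (a ≤? t) a≤t | dec-true (t ≤? b) t≤b = refl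

segSum≡0 : ∀ {P : ℚ → Set} {c} → (∀ {x y} → P x → P y → c ((x + y) * ½) ≡ false) →
           ∀ {xs} → All P xs → segSum c xs ≡ 0ℚ
segSum≡0 cut [] = refl
segSum≡0 cut (_ ∷ []) = refl
segSum≡0 {c = c} cut {x ∷ y ∷ _} (px ∷ py ∷ pxs) =
  cong₂ _+_ (cong (λ b → if b then y - x else 0ℚ) (cut px py)) (segSum≡0 cut (py ∷ pxs))

connectivity≡0 : ∀ I σ {a b} → All (Between a b) (breakpoints I σ) →
                 (∀ {t} → Between a b t → connectedAt I σ t ≡ false) → connectivity I σ ≡ 0ℚ
connectivity≡0 I σ bps cut = segSum≡0 (λ x y → cut (midpoint-between x y))
  (All-resp-↭ (↭-sym (Sort.sort-↭ (breakpoints I σ))) bps)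

disconnected : ∀ I σ e {t iv} → iv ∈ σ e → inIv t iv ≡ true → connectedAt I σ t ≡ false
disconnected I σ e iv∈σe t∈iv = all-false (∈-allFin e) (cong not (any-true iv∈σe t∈iv))

-- The mandatory part [d - p , r + p] of a job, stated without subtraction.
MandatoryAt : Job → ℚ → Set
MandatoryAt j t = ℕ→ℚ (d j) ≤ t + ℕ→ℚ (p j) × t ≤ ℕ→ℚ (r j) + ℕ→ℚ (p j)

module _ {I : Instance} {S : NonPreemptiveSchedule I} (valid : ValidNonPreemptive I S) where

  mandatory⇒disconnected : ∀ e {t} → MandatoryAt (jobs I e) t → connectedAt I (asSchedule I S) t ≡ false
  mandatory⇒disconnected e {t} (d≤t+p , t≤r+p) =
    disconnected I (asSchedule I S) e {t} (here refl) (inIv-between (S≤t , t≤S+p))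
    where
    pₑ = ℕ→ℚ (p (jobs I e))
    r≤S = proj₁ (valid e)
    S+p≤d = proj₂ (valid e)
    S≤t : S e ≤ t
    S≤t = ℚ.≮⇒≥ (λ t<S → ℚ.<-irrefl refl (ℚ.<-≤-trans (ℚ.+-monoˡ-< pₑ t<S) (ℚ.≤-trans S+p≤d d≤t+p)))
    t≤S+p : t ≤ S e + pₑ
    t≤S+p = ℚ.≤-trans t≤r+p (ℚ.+-monoˡ-≤ pₑ r≤S)

  breakpoints-within-horizon : All (Between 0ℚ (ℕ→ℚ (horizon I))) (breakpoints I (asSchedule I S))
  breakpoints-within-horizon =
    (ℚ.≤-refl , 0≤T) ∷ (0≤T , ℚ.≤-refl) ∷ All.concat⁺ (All.map⁺ (tabulate⁺ endpoints))
    where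
    T = ℕ→ℚ (horizon I)
    0≤T = ℕ→ℚ-nonNeg (horizon I)
    endpoints : ∀ e → All (Between 0ℚ T) (S e ∷ S e + ℕ→ℚ (p (jobs I e)) ∷ [])
    endpoints e = (0≤S , ℚ.≤-trans S≤S+p S+p≤T) ∷ (ℚ.≤-trans 0≤S S≤S+p , S+p≤T) ∷ []
      where
      pₑ = ℕ→ℚ (p (jobs I e))
      0≤S : 0ℚ ≤ S e
      0≤S = ℚ.≤-trans (ℕ→ℚ-nonNeg (r (jobs I e))) (proj₁ (valid e))
      S≤S+p : S e ≤ S e + pₑ
      S≤S+p = p≤p+q (S e) (ℕ→ℚ-nonNeg (p (jobs I e)))
      S+p≤T : S e + pₑ ≤ T
      S+p≤T = ℚ.≤-trans (proj₂ (valid e)) (ℕ→ℚ-mono-≤ (deadline≤horizon I e))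

I₀ : Instance
I₀ = inst 3 λ where
  zero             → job 1 0 1
  (suc zero)       → job 2 0 3
  (suc (suc zero)) → job 1 2 3

I₀-mandatory-cover : ∀ {t} → Between 0ℚ (ℕ→ℚ 3) t → ∃ λ e → MandatoryAt (jobs I₀ e) t
I₀-mandatory-cover {t} (0≤t , t≤3) with t ≤? ℕ→ℚ 1 | t ≤? ℕ→ℚ 2
... | yes t≤1 | _       = zero , ℚ.+-monoˡ-≤ (ℕ→ℚ 1) 0≤t , t≤1
... | no  t≰1 | yes t≤2 = suc zero , ℚ.+-monoˡ-≤ (ℕ→ℚ 2) (ℚ.<⇒≤ (ℚ.≰⇒> t≰1)) , t≤2
... | no  _   | no  t≰2 = suc (suc zero) , ℚ.+-monoˡ-≤ (ℕ→ℚ 1) (ℚ.<⇒≤ (ℚ.≰⇒> t≰2)) , t≤3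

I₀-nonPreemptive-disconnected : ∀ S → ValidNonPreemptive I₀ S → connectivity I₀ (asSchedule I₀ S) ≡ 0ℚ
I₀-nonPreemptive-disconnected S valid =
  connectivity≡0 I₀ (asSchedule I₀ S) (breakpoints-within-horizon {I₀} {S} valid) cut
  where
  cut : ∀ {t} → Between 0ℚ (ℕ→ℚ 3) t → connectedAt I₀ (asSchedule I₀ S) t ≡ false
  cut t∈[0,3] with I₀-mandatory-cover t∈[0,3]
  ... | e , mandatory = mandatory⇒disconnected {I₀} {S} valid e mandatory

decide-≤ : ∀ {p q} {p≤q : True (p ≤? q)} → p ≤ q
decide-≤ {p≤q = p≤q} = toWitness p≤q

decide-< : ∀ {p q} {p<q : True (p <? q)} → p < q
decide-< {p<q = p<q} = toWitness p<q

σ₀ : PreemptiveSchedule I₀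
σ₀ zero             = (0ℚ , ℕ→ℚ 1) ∷ []
σ₀ (suc zero)       = (0ℚ , ℕ→ℚ 1) ∷ (ℕ→ℚ 2 , ℕ→ℚ 3) ∷ []
σ₀ (suc (suc zero)) = (ℕ→ℚ 2 , ℕ→ℚ 3) ∷ []

σ₀-valid : ValidPreemptive I₀ σ₀
σ₀-valid zero             = (decide-≤ , decide-≤ , decide-≤) ∷ [] , [] ∷ [] , refl
σ₀-valid (suc zero)       =
  (decide-≤ , decide-≤ , decide-≤) ∷ (decide-≤ , decide-≤ , decide-≤) ∷ [] ,
  (inj₁ decide-< ∷ []) ∷ [] ∷ [] , refl
σ₀-valid (suc (suc zero)) = (decide-≤ , decide-≤ , decide-≤) ∷ [] , [] ∷ [] , refl

σ₀-connectivity : connectivity I₀ σ₀ ≡ 1ℚ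
σ₀-connectivity = cong (segSum (connectedAt I₀ σ₀)) (sort≡insertionSort (breakpoints I₀ σ₀))

theorem8 : Σ Instance λ I →
    ((S : NonPreemptiveSchedule I) → ValidNonPreemptive I S →
      connectivity I (asSchedule I S) ≡ 0ℚ)
    × Σ (PreemptiveSchedule I) λ σ → ValidPreemptive I σ × (0ℚ < connectivity I σ)
theorem8 = I₀ , I₀-nonPreemptive-disconnected , σ₀ , σ₀-valid , 0<σ₀-connectivity
  where
  0<σ₀-connectivity : 0ℚ < connectivity I₀ σ₀
  0<σ₀-connectivity = subst (0ℚ <_) (sym σ₀-connectivity) decide-<
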